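{- Let $p$ be a prime and let $\epsilon$ be defined as follows: $\epsilon = 1$ if $p = 2$ or $p \equiv 3 \pmod 4$; $\epsilon = 2$ if $p \equiv 5 \pmod 8$; and if $p \equiv 1 \pmod 8$, $\epsilon = r$ for some prime $r \equiv 3 \pmod 4$ with Legendre symbol $\left(\frac{r}{p}\right) = -1$. Let $\ell \neq p$ be an odd prime and let $m \geq 2$ be an integer. Suppose $A_0, B_0 \in \mathrm{M}_2(\mathbb{Z}/\ell^m\mathbb{Z})$ are trace-free matrices satisfying $$A_0^2 = -\epsilon, \qquad B_0^2 = -p, \qquad A_0B_0 = -B_0A_0 \pmod{\ell^m}.$$ Then there exist trace-free matrices $A_1, B_1 \in \mathrm{M}_2(\mathbb{Z}/\ell^{m+1}\mathbb{Z})$ with $A_1 \equiv A_0 \pmod{\ell^m}$, $B_1 \equiv B_0 \pmod{\ell^m}$, satisfying $$A_1^2 = -\epsilon, \qquad B_1^2 = -p, \qquad A_1B_1 = -B_1A_1 \pmod{\ell^{m+1}}.$$ Consequently, there exist matrices $A, B \in \mathrm{M}_2(\mathbb{Z}_\ell)$ with $A \equiv A_0$ and $B \equiv B_0 \pmod{\ell^m}$ such that $A^2 = -\epsilon$, $B^2 = -p$ and $AB = -BA$.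
   Context: Here $\epsilon$ is chosen so that the quaternion algebra $\left(\frac{ -\epsilon,-p}{\mathbb{Q}}\right)$ is the quaternion algebra over $\mathbb{Q}$ ramified exactly at $\{p,\infty\}$. Scalars such as $-\epsilon$ and $-p$ are identified with the corresponding scalar matrices. $\mathbb{Z}_\ell$ denotes the $\ell$-adic integers. -}

module Defs where

open import Data.Nat as ℕ using (ℕ; suc; _%_)
open import Data.Nat.Primality using (Prime)
open import Data.Integer as ℤ using (ℤ; +_; _+_; _-_; _*_; -_)
open import Data.Integer.Divisibility using (_∣_)
open import Data.Product using (Σ; ∃; _×_)
open import Data.Sum using (_⊎_)
open import Relation.Nullary using (¬_)
open import Relation.Binary.PropositionalEquality using (_≡_)

_≡_[mod_] : ℤ → ℤ → ℕ → Set
a ≡ b [mod q ] = (+ q) ∣ (a - b)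

LegendreMinusOne : ℕ → ℕ → Set
LegendreMinusOne r p =
  ¬ ((+ p) ∣ (+ r)) × ¬ (Σ ℤ λ x → (x * x) ≡ (+ r) [mod p ])

IsEpsilon : ℕ → ℕ → Set
IsEpsilon p ε =
    (p ≡ 2 × ε ≡ 1)
  ⊎ (p % 4 ≡ 3 × ε ≡ 1)
  ⊎ (p % 8 ≡ 5 × ε ≡ 2)
  ⊎ (p % 8 ≡ 1 × Prime ε × ε % 4 ≡ 3 × LegendreMinusOne ε p)

record M2 (A : Set) : Set where
  constructor mat
  field a b c d : A
open M2 public

-- integer matrices represent matrices over ℤ/qℤ via reduction
_*ᴹ_ : M2 ℤ → M2 ℤ → M2 ℤ
X *ᴹ Y = mat (a X * a Y + b X * c Y) (a X * b Y + b X * d Y)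
             (c X * a Y + d X * c Y) (c X * b Y + d X * d Y)

negᴹ : M2 ℤ → M2 ℤ
negᴹ X = mat (- a X) (- b X) (- c X) (- d X)

scalar : ℤ → M2 ℤ
scalar s = mat s (+ 0) (+ 0) s

_≡ᴹ_[mod_] : M2 ℤ → M2 ℤ → ℕ → Set
X ≡ᴹ Y [mod q ] =
  (a X ≡ a Y [mod q ]) × (b X ≡ b Y [mod q ]) ×
  (c X ≡ c Y [mod q ]) × (d X ≡ d Y [mod q ])

TraceFree : ℕ → M2 ℤ → Set
TraceFree q X = (a X + d X) ≡ (+ 0) [mod q ]

QuatRel : ℕ → ℕ → ℕ → M2 ℤ → M2 ℤ → Set
QuatRel q ε p A B =
  ((A *ᴹ A) ≡ᴹ scalar (- (+ ε)) [mod q ]) ×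
  ((B *ᴹ B) ≡ᴹ scalar (- (+ p)) [mod q ]) ×
  ((A *ᴹ B) ≡ᴹ negᴹ (B *ᴹ A) [mod q ])

-- ℓ-adic integers ℤ_ℓ as the inverse limit of ℤ/ℓⁿℤ:
-- coherent sequences x with x (n+1) ≡ x n (mod ℓⁿ); x n represents the image in ℤ/ℓⁿℤ.
record ℤ-adic (ℓ : ℕ) : Set where
  constructor padic
  field
    digits : ℕ → ℤ
    coherent : ∀ n → digits (suc n) ≡ digits n [mod ℓ ℕ.^ n ]
open ℤ-adic public

reduce : {ℓ : ℕ} → M2 (ℤ-adic ℓ) → ℕ → M2 ℤ
reduce X n = mat (digits (a X) n) (digits (b X) n) (digits (c X) n) (digits (d X) n)

-- Put A₁ = A₀ + ℓᵐX and B₁ = (1 + ℓᵐγ)B₀, then take trace-free parts. As ℓ ∣ ℓᵐ, only the first-order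
-- terms matter modulo ℓᵐ⁺¹: writing A₀² + ε = ℓᵐs, B₀² + p = ℓᵐt and A₀B₀ + B₀A₀ = ℓᵐk, the relations lift
-- iff 2pγ ≡ t, ⟪A₀,X⟫ ≡ -s and ⟪B₀,X⟫ ≡ -k (mod ℓ), where ⟪X,Y⟫ = XY + YX is the polar form of X ↦ X² on
-- trace-free matrices. The first congruence is solvable as ℓ ∤ 2p. The other two form a 2 × 3 linear system,
-- solvable unless the forms ⟪A₀,·⟫ and ⟪B₀,·⟫ are proportional mod ℓ; since ⟪B₀,B₀⟫ ≡ -2p ≢ 0 and
-- ⟪A₀,B₀⟫ ≡ 0, proportionality would force A₀ ≡ 0 (mod ℓ), so ℓ² would divide A₀² ≡ -ε (mod ℓ², as m ≥ 2),
-- impossible because ε is 1 or a prime. Iterating the lift gives a coherent sequence, i.e. a solution over ℤ_ℓ.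

module Submission where

open import Defs
open import Data.Nat using (ℕ; _≤_; suc; _^_)
open import Data.Integer using (ℤ)
open import Relation.Binary.PropositionalEquality using (_≢_)
open import Data.Nat.Primality using (Prime)
open import Data.Product using (Σ; _×_)

open import Data.Nat as ℕ using (zero; z≤n; s≤s; _∸_; _≤?_)
open import Data.Nat.Properties as ℕ using (≤-trans; m≤n+m; +-∸-assoc; m∸n+n≡m; m≤n⇒m∸n≡0; n∸n≡0; ≰⇒>; <⇒≤)
open import Data.Nat.Divisibility as ℕ using () renaming (_∣_ to _∣ℕ_)
open import Data.Nat.Coprimality using (Coprime; coprime-Bézout)
open import Data.Nat.GCD using (module Bézout)
open import Data.Nat.Primality using (prime⇒irreducible; prime[2]; ¬prime[1]; euclidsLemma; prime⇒nonZero)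
open import Data.Integer using (+_; -_; _+_; _-_; _*_) renaming (∣_∣ to abs)
open import Data.Integer.Properties using (pos-*; pos-+; abs-*; neg-involutive; +-inverseʳ; neg-distribˡ-*; +-comm; *-distribˡ-+; +∣i∣≡i⊎+∣i∣≡-i)
open import Data.Integer.Divisibility.Signed
open import Data.Integer.Tactic.RingSolver using (solve-∀)
open import Data.Product using (_,_; proj₁; proj₂)
open import Data.Sum using (_⊎_; inj₁; inj₂)
open import Data.Empty using (⊥-elim)
open import Function using (_∘_)
open import Relation.Nullary using (¬_; yes; no)
open import Relation.Binary.PropositionalEquality using (_≡_; refl; sym; trans; cong; cong₂; subst; module ≡-Reasoning)

∣0 : ∀ {k} → k ∣ + 0
∣0 = divides (+ 0) refl

∣-*-∣ : ∀ {k l x y} → k ∣ x → l ∣ y → k * l ∣ x * y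
∣-*-∣ {k} {l} {x} k∣x l∣y = ∣-trans (*-monoˡ-∣ l k∣x) (*-monoʳ-∣ x l∣y)

m*m∣n⇒m∣n : ∀ {m n} → m * m ∣ n → m ∣ n
m*m∣n⇒m∣n {m} = ∣-trans (∣m⇒∣m*n m ∣-refl)

∣⇒≡-mod : ∀ {N z} x y → x - y ≡ z → + N ∣ z → x ≡ y [mod N ]
∣⇒≡-mod {N} x y x-y≡z N∣z = ∣⇒∣ᵤ {+ N} {x - y} (subst (+ N ∣_) (sym x-y≡z) N∣z)

≡-neg-mod⇒∣ : ∀ {N} x y → x ≡ - y [mod N ] → + N ∣ x + y
≡-neg-mod⇒∣ {N} x y h = subst (λ z → + N ∣ x + z) (neg-involutive y) (∣ᵤ⇒∣ h)

≡-mod-refl : ∀ {N} x → x ≡ x [mod N ]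
≡-mod-refl x = ∣⇒≡-mod x x (+-inverseʳ x) ∣0

≡-mod-weaken : ∀ {M N} x y → M ∣ℕ N → x ≡ y [mod N ] → x ≡ y [mod M ]
≡-mod-weaken x y M∣N h = ℕ.∣-trans M∣N h

≡ᴹ-refl : ∀ {N} X → X ≡ᴹ X [mod N ]
≡ᴹ-refl X = ≡-mod-refl (a X) , ≡-mod-refl (b X) , ≡-mod-refl (c X) , ≡-mod-refl (d X)

≡ᴹ-weaken : ∀ {M N} X Y → M ∣ℕ N → X ≡ᴹ Y [mod N ] → X ≡ᴹ Y [mod M ]
≡ᴹ-weaken X Y M∣N (ha , hb , hc , hd) =
  ≡-mod-weaken (a X) (a Y) M∣N ha , ≡-mod-weaken (b X) (b Y) M∣N hb ,
  ≡-mod-weaken (c X) (c Y) M∣N hc , ≡-mod-weaken (d X) (d Y) M∣N hd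

quatRel-weaken : ∀ {M N ε p} A B → M ∣ℕ N → QuatRel N ε p A B → QuatRel M ε p A B
quatRel-weaken {ε = ε} {p} A B M∣N (hA , hB , hAB) =
  ≡ᴹ-weaken (A *ᴹ A) (scalar (- + ε)) M∣N hA ,
  ≡ᴹ-weaken (B *ᴹ B) (scalar (- + p)) M∣N hB ,
  ≡ᴹ-weaken (A *ᴹ B) (negᴹ (B *ᴹ A)) M∣N hAB

infixl 6 _+ᴹ_
infixl 7 _·ᴹ_

_+ᴹ_ : M2 ℤ → M2 ℤ → M2 ℤ
X +ᴹ Y = mat (a X + a Y) (b X + b Y) (c X + c Y) (d X + d Y)

_·ᴹ_ : ℤ → M2 ℤ → M2 ℤ
k ·ᴹ X = mat (k * a X) (k * b X) (k * c X) (k * d X)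

-- For trace-free X and Y, XY + YX is the scalar ⟪ X , Y ⟫.
⟪_,_⟫ : M2 ℤ → M2 ℤ → ℤ
⟪ X , Y ⟫ = a (X *ᴹ Y) + a (Y *ᴹ X)

traceFreePart : M2 ℤ → M2 ℤ
traceFreePart X = mat (a X) (b X) (c X) (- a X)

traceFreePart-traceFree : ∀ N X → TraceFree N (traceFreePart X)
traceFreePart-traceFree N X = ∣⇒≡-mod (a X + - a X) (+ 0) (x-x+0≡0 (a X)) ∣0
  where
  x-x+0≡0 : ∀ x → x + - x - + 0 ≡ + 0
  x-x+0≡0 = solve-∀

square-traceFreePart : ∀ N e X → + N ∣ a (X *ᴹ X) + e →
  (traceFreePart X *ᴹ traceFreePart X) ≡ᴹ scalar (- e) [mod N ]
square-traceFreePart N e (mat x y z _) h =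
  ∣⇒≡-mod (x * x + y * z) (- e) (entry₁₁ x y z e) h , ∣⇒≡-mod (x * y + y * - x) (+ 0) (entry₁₂ x y) ∣0 ,
  ∣⇒≡-mod (z * x + - x * z) (+ 0) (entry₂₁ x z) ∣0 , ∣⇒≡-mod (z * y + - x * - x) (- e) (entry₂₂ x y z e) h
  where
  entry₁₁ : ∀ x y z e → x * x + y * z - - e ≡ x * x + y * z + e
  entry₁₁ = solve-∀
  entry₁₂ : ∀ x y → x * y + y * - x - + 0 ≡ + 0
  entry₁₂ = solve-∀
  entry₂₁ : ∀ x z → z * x + - x * z - + 0 ≡ + 0
  entry₂₁ = solve-∀
  entry₂₂ : ∀ x y z e → z * y + - x * - x - - e ≡ x * x + y * z + e
  entry₂₂ = solve-∀

anticommute-traceFreePart : ∀ N X Y → + N ∣ ⟪ X , Y ⟫ →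
  (traceFreePart X *ᴹ traceFreePart Y) ≡ᴹ negᴹ (traceFreePart Y *ᴹ traceFreePart X) [mod N ]
anticommute-traceFreePart N (mat x y z _) (mat x′ y′ z′ _) h =
  ∣⇒≡-mod (x * x′ + y * z′) (- (x′ * x + y′ * z)) (entry₁₁ x y z x′ y′ z′) h ,
  ∣⇒≡-mod (x * y′ + y * - x′) (- (x′ * y + y′ * - x)) (entry₁₂ x y x′ y′) ∣0 ,
  ∣⇒≡-mod (z * x′ + - x * z′) (- (z′ * x + - x′ * z)) (entry₂₁ x z x′ z′) ∣0 ,
  ∣⇒≡-mod (z * y′ + - x * - x′) (- (z′ * y + - x′ * - x)) (entry₂₂ x y z x′ y′ z′) h
  where
  entry₁₁ : ∀ x y z x′ y′ z′ → x * x′ + y * z′ - - (x′ * x + y′ * z) ≡ x * x′ + y * z′ + (x′ * x + y′ * z)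
  entry₁₁ = solve-∀
  entry₁₂ : ∀ x y x′ y′ → x * y′ + y * - x′ - - (x′ * y + y′ * - x) ≡ + 0
  entry₁₂ = solve-∀
  entry₂₁ : ∀ x z x′ z′ → z * x′ + - x * z′ - - (z′ * x + - x′ * z) ≡ + 0
  entry₂₁ = solve-∀
  entry₂₂ : ∀ x y z x′ y′ z′ → z * y′ + - x * - x′ - - (z′ * y + - x′ * - x) ≡ x * x′ + y * z′ + (x′ * x + y′ * z)
  entry₂₂ = solve-∀

quatRel-traceFreePart : ∀ {N ε p} A B →
  + N ∣ a (A *ᴹ A) + + ε → + N ∣ a (B *ᴹ B) + + p → + N ∣ ⟪ A , B ⟫ →
  QuatRel N ε p (traceFreePart A) (traceFreePart B)
quatRel-traceFreePart {N} {ε} {p} A B hA hB hAB =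
  square-traceFreePart N (+ ε) A hA , square-traceFreePart N (+ p) B hB ,
  anticommute-traceFreePart N A B hAB

traceFreePart-lift : ∀ {N} A X → TraceFree N A → traceFreePart (A +ᴹ + N ·ᴹ X) ≡ᴹ A [mod N ]
traceFreePart-lift {N} (mat x y z w) (mat x′ y′ z′ _) tf =
  ∣⇒≡-mod (x + + N * x′) x (shift x x′ (+ N)) (∣n⇒∣m*n x′ ∣-refl) ,
  ∣⇒≡-mod (y + + N * y′) y (shift y y′ (+ N)) (∣n⇒∣m*n y′ ∣-refl) ,
  ∣⇒≡-mod (z + + N * z′) z (shift z z′ (+ N)) (∣n⇒∣m*n z′ ∣-refl) ,
  ∣⇒≡-mod (- (x + + N * x′)) w (shift-trace x w x′ (+ N))
    (∣m∣n⇒∣m+n (∣m⇒∣-m (∣ᵤ⇒∣ {+ N} {x + w - + 0} tf)) (∣n⇒∣m*n (- x′) ∣-refl))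
  where
  shift : ∀ x x′ Q → x + Q * x′ - x ≡ x′ * Q
  shift = solve-∀
  shift-trace : ∀ x w x′ Q → - (x + Q * x′) - w ≡ - (x + w - + 0) + - x′ * Q
  shift-trace = solve-∀

a-*ᴹ-first-order : ∀ {L Q} A B X Y → L ∣ Q →
  L * Q ∣ a ((A +ᴹ Q ·ᴹ X) *ᴹ (B +ᴹ Q ·ᴹ Y)) - (a (A *ᴹ B) + Q * (a (A *ᴹ Y) + a (X *ᴹ B)))
a-*ᴹ-first-order {L} {Q} (mat a₁ b₁ _ _) (mat a₂ _ c₂ _) (mat x₁ y₁ _ _) (mat x₂ _ z₂ _) L∣Q =
  subst (L * Q ∣_) (sym (expand a₁ b₁ a₂ c₂ x₁ y₁ x₂ z₂ Q))
    (∣m⇒∣m*n (x₁ * x₂ + y₁ * z₂) (*-monoˡ-∣ Q L∣Q))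
  where
  expand : ∀ a₁ b₁ a₂ c₂ x₁ y₁ x₂ z₂ Q →
    (a₁ + Q * x₁) * (a₂ + Q * x₂) + (b₁ + Q * y₁) * (c₂ + Q * z₂)
      - (a₁ * a₂ + b₁ * c₂ + Q * ((a₁ * x₂ + b₁ * z₂) + (x₁ * a₂ + y₁ * c₂)))
    ≡ Q * Q * (x₁ * x₂ + y₁ * z₂)
  expand = solve-∀

lift-square : ∀ {L Q e} A X → L ∣ Q → L * Q ∣ a (A *ᴹ A) + e + Q * ⟪ A , X ⟫ →
  L * Q ∣ a ((A +ᴹ Q ·ᴹ X) *ᴹ (A +ᴹ Q ·ᴹ X)) + e
lift-square {L} {Q} {e} A X L∣Q h =
  subst (L * Q ∣_) (sym (regroup (a ((A +ᴹ Q ·ᴹ X) *ᴹ (A +ᴹ Q ·ᴹ X))) (a (A *ᴹ A)) (a (A *ᴹ X)) (a (X *ᴹ A)) e Q))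
    (∣m∣n⇒∣m+n h (a-*ᴹ-first-order A A X X L∣Q))
  where
  regroup : ∀ s t u v e Q → s + e ≡ (t + e + Q * (u + v)) + (s - (t + Q * (u + v)))
  regroup = solve-∀

lift-polar : ∀ {L Q} A B X Y → L ∣ Q → L * Q ∣ ⟪ A , B ⟫ + Q * (⟪ A , Y ⟫ + ⟪ X , B ⟫) →
  L * Q ∣ ⟪ A +ᴹ Q ·ᴹ X , B +ᴹ Q ·ᴹ Y ⟫
lift-polar {L} {Q} A B X Y L∣Q h =
  subst (L * Q ∣_)
    (sym (regroup (a ((A +ᴹ Q ·ᴹ X) *ᴹ (B +ᴹ Q ·ᴹ Y))) (a ((B +ᴹ Q ·ᴹ Y) *ᴹ (A +ᴹ Q ·ᴹ X)))
                  (a (A *ᴹ B)) (a (B *ᴹ A)) (a (A *ᴹ Y)) (a (X *ᴹ B)) (a (Y *ᴹ A)) (a (B *ᴹ X)) Q))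
    (∣m∣n⇒∣m+n (∣m∣n⇒∣m+n h (a-*ᴹ-first-order A B X Y L∣Q)) (a-*ᴹ-first-order B A Y X L∣Q))
  where
  regroup : ∀ p q r s u v w z Q →
    p + q ≡ (r + s + Q * ((u + w) + (v + z))) + (p - (r + Q * (u + v))) + (q - (s + Q * (z + w)))
  regroup = solve-∀

prime∤1 : ∀ {ℓ} → Prime ℓ → ¬ (ℓ ∣ℕ 1)
prime∤1 ℓ-prime ℓ∣1 = ¬prime[1] (subst Prime (ℕ.∣1⇒≡1 ℓ∣1) ℓ-prime)

prime∣prime⇒≡ : ∀ {ℓ q} → Prime ℓ → Prime q → ℓ ∣ℕ q → ℓ ≡ q
prime∣prime⇒≡ ℓ-prime q-prime ℓ∣q with prime⇒irreducible q-prime ℓ∣q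
... | inj₁ refl = ⊥-elim (¬prime[1] ℓ-prime)
... | inj₂ ℓ≡q = ℓ≡q

prime-square∤prime : ∀ {ℓ q} → Prime ℓ → Prime q → ¬ (ℓ ℕ.* ℓ ∣ℕ q)
prime-square∤prime {ℓ} {q} ℓ-prime q-prime ℓ²∣q
  with prime∣prime⇒≡ ℓ-prime q-prime (ℕ.∣-trans (ℕ.m∣m*n ℓ) ℓ²∣q)
... | refl = prime∤1 q-prime (ℕ.*-cancelˡ-∣ q (subst (q ℕ.* q ∣ℕ_) (sym (ℕ.*-identityʳ q)) ℓ²∣q))
  where instance _ = prime⇒nonZero q-prime

IsEpsilon⇒≡1⊎prime : ∀ {p ε} → IsEpsilon p ε → ε ≡ 1 ⊎ Prime ε
IsEpsilon⇒≡1⊎prime (inj₁ (_ , ε≡1)) = inj₁ ε≡1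
IsEpsilon⇒≡1⊎prime (inj₂ (inj₁ (_ , ε≡1))) = inj₁ ε≡1
IsEpsilon⇒≡1⊎prime (inj₂ (inj₂ (inj₁ (_ , refl)))) = inj₂ prime[2]
IsEpsilon⇒≡1⊎prime (inj₂ (inj₂ (inj₂ (_ , ε-prime , _)))) = inj₂ ε-prime

prime-square∤ε : ∀ {ℓ p ε} → Prime ℓ → IsEpsilon p ε → ¬ (ℓ ℕ.* ℓ ∣ℕ ε)
prime-square∤ε ℓ-prime ε-ok with IsEpsilon⇒≡1⊎prime ε-ok
... | inj₁ refl = prime∤1 ℓ-prime ∘ ℕ.∣-trans (ℕ.m∣m*n _)
... | inj₂ ε-prime = prime-square∤prime ℓ-prime ε-prime

euclidsLemma-ℤ : ∀ {ℓ} x y → Prime ℓ → + ℓ ∣ x * y → + ℓ ∣ x ⊎ + ℓ ∣ y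
euclidsLemma-ℤ {ℓ} x y ℓ-prime ℓ∣xy with euclidsLemma (abs x) (abs y) ℓ-prime (subst (ℓ ∣ℕ_) (abs-* x y) (∣⇒∣ᵤ ℓ∣xy))
... | inj₁ ℓ∣x = inj₁ (∣ᵤ⇒∣ ℓ∣x)
... | inj₂ ℓ∣y = inj₂ (∣ᵤ⇒∣ ℓ∣y)

prime∣m*n∤n⇒∣m : ∀ {ℓ} x y → Prime ℓ → ¬ (+ ℓ ∣ y) → + ℓ ∣ x * y → + ℓ ∣ x
prime∣m*n∤n⇒∣m x y ℓ-prime ℓ∤y ℓ∣xy with euclidsLemma-ℤ x y ℓ-prime ℓ∣xy
... | inj₁ ℓ∣x = ℓ∣x
... | inj₂ ℓ∣y = ⊥-elim (ℓ∤y ℓ∣y)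

prime∣m*n∤m⇒∣n : ∀ {ℓ} x y → Prime ℓ → ¬ (+ ℓ ∣ x) → + ℓ ∣ x * y → + ℓ ∣ y
prime∣m*n∤m⇒∣n x y ℓ-prime ℓ∤x ℓ∣xy with euclidsLemma-ℤ x y ℓ-prime ℓ∣xy
... | inj₁ ℓ∣x = ⊥-elim (ℓ∤x ℓ∣x)
... | inj₂ ℓ∣y = ℓ∣y

odd-prime∤2p : ∀ {ℓ p} → Prime ℓ → ℓ ≢ 2 → Prime p → ℓ ≢ p → ¬ (+ ℓ ∣ + 2 * + p)
odd-prime∤2p ℓ-prime ℓ≢2 p-prime ℓ≢p ℓ∣2p with euclidsLemma-ℤ (+ 2) _ ℓ-prime ℓ∣2p
... | inj₁ ℓ∣2 = ℓ≢2 (prime∣prime⇒≡ ℓ-prime prime[2] (∣⇒∣ᵤ ℓ∣2))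
... | inj₂ ℓ∣p = ℓ≢p (prime∣prime⇒≡ ℓ-prime p-prime (∣⇒∣ᵤ ℓ∣p))

prime∤⇒coprime : ∀ {ℓ n} → Prime ℓ → ¬ (ℓ ∣ℕ n) → Coprime ℓ n
prime∤⇒coprime ℓ-prime ℓ∤n (d∣ℓ , d∣n) with prime⇒irreducible ℓ-prime d∣ℓ
... | inj₁ d≡1 = d≡1
... | inj₂ refl = ⊥-elim (ℓ∤n d∣n)

Bézout-ℤ : ∀ k m u v → 1 ℕ.+ k ℕ.* m ≡ u ℕ.* v → + 1 + + k * + m ≡ + u * + v
Bézout-ℤ k m u v eq =
  trans (cong (_+_ (+ 1)) (sym (pos-* k m))) (trans (sym (pos-+ 1 (k ℕ.* m))) (trans (cong +_ eq) (pos-* u v)))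

inverse-mod-primeℕ : ∀ {ℓ n} → Prime ℓ → ¬ (ℓ ∣ℕ n) → Σ ℤ λ ν → + ℓ ∣ ν * + n - + 1
inverse-mod-primeℕ {ℓ} {n} ℓ-prime ℓ∤n with coprime-Bézout (prime∤⇒coprime ℓ-prime ℓ∤n)
... | Bézout.+- x y eq = - + y , divides (- + x) (negated (+ x) (+ y) (+ n) (+ ℓ) (Bézout-ℤ y n x ℓ eq))
  where
  negated : ∀ x y n ℓ → + 1 + y * n ≡ x * ℓ → - y * n - + 1 ≡ - x * ℓ
  negated x y n ℓ eq = trans (rearrange y n) (trans (cong -_ eq) (neg-distribˡ-* x ℓ))
    where
    rearrange : ∀ y n → - y * n - + 1 ≡ - (+ 1 + y * n)
    rearrange = solve-∀
... | Bézout.-+ x y eq = + y , divides (+ x) (shifted (+ x) (+ y) (+ n) (+ ℓ) (Bézout-ℤ x ℓ y n eq))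
  where
  shifted : ∀ x y n ℓ → + 1 + x * ℓ ≡ y * n → y * n - + 1 ≡ x * ℓ
  shifted x y n ℓ eq = trans (cong (_- + 1) (sym eq)) (cancel x ℓ)
    where
    cancel : ∀ x ℓ → + 1 + x * ℓ - + 1 ≡ x * ℓ
    cancel = solve-∀

inverse-mod-prime : ∀ {ℓ} z → Prime ℓ → ¬ (+ ℓ ∣ z) → Σ ℤ λ ν → + ℓ ∣ ν * z - + 1
inverse-mod-prime {ℓ} z ℓ-prime ℓ∤z with inverse-mod-primeℕ {n = abs z} ℓ-prime (λ ℓ∣z → ℓ∤z (∣ᵤ⇒∣ ℓ∣z)) | +∣i∣≡i⊎+∣i∣≡-i z
... | ν , ℓ∣νz-1 | inj₁ ∣z∣≡z = ν , subst (λ w → + ℓ ∣ ν * w - + 1) ∣z∣≡z ℓ∣νz-1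
... | ν , ℓ∣νz-1 | inj₂ ∣z∣≡-z = - ν , subst (λ w → + ℓ ∣ w - + 1) (trans (cong (ν *_) ∣z∣≡-z) (swap-neg ν z)) ℓ∣νz-1
  where
  swap-neg : ∀ ν z → ν * - z ≡ - ν * z
  swap-neg = solve-∀

record ℤ³ : Set where
  constructor ⟨_,_,_⟩
  field x₁ x₂ x₃ : ℤ
open ℤ³

infix 7 _∙_ _⨯_

_∙_ : ℤ³ → ℤ³ → ℤ
u ∙ v = x₁ u * x₁ v + x₂ u * x₂ v + x₃ u * x₃ v

_⨯_ : ℤ³ → ℤ³ → ℤ³
u ⨯ v = ⟨ x₂ u * x₃ v - x₃ u * x₂ v , x₃ u * x₁ v - x₁ u * x₃ v , x₁ u * x₂ v - x₂ u * x₁ v ⟩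

rotate : ℤ³ → ℤ³
rotate u = ⟨ x₂ u , x₃ u , x₁ u ⟩

infix 4 _∣³_

_∣³_ : ℤ → ℤ³ → Set
k ∣³ u = k ∣ x₁ u × k ∣ x₂ u × k ∣ x₃ u

SolvableMod : ℤ → ℤ³ → ℤ³ → ℤ → ℤ → Set
SolvableMod L u v s k = Σ ℤ³ λ x → L ∣ s + u ∙ x × L ∣ k + v ∙ x

cramer : ∀ {ℓ} u v s k → Prime ℓ → ¬ (+ ℓ ∣ x₃ (u ⨯ v)) → SolvableMod (+ ℓ) u v s k
cramer ⟨ u₁ , u₂ , u₃ ⟩ ⟨ v₁ , v₂ , v₃ ⟩ s k ℓ-prime ℓ∤δ
  with inverse-mod-prime (u₁ * v₂ - u₂ * v₁) ℓ-prime ℓ∤δ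
... | ν , ℓ∣νδ-1 =
  ⟨ ν * (k * u₂ - s * v₂) , ν * (s * v₁ - k * u₁) , + 0 ⟩ ,
  subst (_ ∣_) (sym (first u₁ u₂ u₃ v₁ v₂ s k ν)) (∣n⇒∣m*n (- s) ℓ∣νδ-1) ,
  subst (_ ∣_) (sym (second u₁ u₂ v₁ v₂ v₃ s k ν)) (∣n⇒∣m*n (- k) ℓ∣νδ-1)
  where
  first : ∀ u₁ u₂ u₃ v₁ v₂ s k ν →
    s + (u₁ * (ν * (k * u₂ - s * v₂)) + u₂ * (ν * (s * v₁ - k * u₁)) + u₃ * + 0)
    ≡ - s * (ν * (u₁ * v₂ - u₂ * v₁) - + 1)
  first = solve-∀
  second : ∀ u₁ u₂ v₁ v₂ v₃ s k ν →
    k + (v₁ * (ν * (k * u₂ - s * v₂)) + v₂ * (ν * (s * v₁ - k * u₁)) + v₃ * + 0)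
    ≡ - k * (ν * (u₁ * v₂ - u₂ * v₁) - + 1)
  second = solve-∀

∙-rotate : ∀ u x → rotate u ∙ rotate x ≡ u ∙ x
∙-rotate ⟨ u₁ , u₂ , u₃ ⟩ ⟨ x₁ , x₂ , x₃ ⟩ = cycle u₁ u₂ u₃ x₁ x₂ x₃
  where
  cycle : ∀ u₁ u₂ u₃ x₁ x₂ x₃ → u₂ * x₂ + u₃ * x₃ + u₁ * x₁ ≡ u₁ * x₁ + u₂ * x₂ + u₃ * x₃
  cycle = solve-∀

solvable-rotate : ∀ {L} u v s k → SolvableMod L (rotate u) (rotate v) s k → SolvableMod L u v s k
solvable-rotate {L} u v s k (x , L∣s+ux , L∣k+vx) =
  rotate (rotate x) ,
  subst (λ t → L ∣ s + t) (∙-rotate u (rotate (rotate x))) L∣s+ux ,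
  subst (λ t → L ∣ k + t) (∙-rotate v (rotate (rotate x))) L∣k+vx

solvable-mod-prime : ∀ {ℓ} u v s k → Prime ℓ → ¬ (+ ℓ ∣³ u ⨯ v) → SolvableMod (+ ℓ) u v s k
solvable-mod-prime {ℓ} u v s k ℓ-prime ℓ∤u⨯v with + ℓ ∣? x₃ (u ⨯ v) | + ℓ ∣? x₁ (u ⨯ v) | + ℓ ∣? x₂ (u ⨯ v)
... | no ℓ∤δ₃ | _ | _ = cramer u v s k ℓ-prime ℓ∤δ₃
... | yes _ | no ℓ∤δ₁ | _ = solvable-rotate u v s k (cramer (rotate u) (rotate v) s k ℓ-prime ℓ∤δ₁)
... | yes _ | yes _ | no ℓ∤δ₂ =
  solvable-rotate u v s k (solvable-rotate (rotate u) (rotate v) s k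
    (cramer (rotate (rotate u)) (rotate (rotate v)) s k ℓ-prime ℓ∤δ₂))
... | yes ℓ∣δ₃ | yes ℓ∣δ₁ | yes ℓ∣δ₂ = ⊥-elim (ℓ∤u⨯v (ℓ∣δ₁ , ℓ∣δ₂ , ℓ∣δ₃))

bac-cab₁ : ∀ u v w → x₁ u * (v ∙ w) ≡ x₂ w * x₃ (u ⨯ v) - x₃ w * x₂ (u ⨯ v) + x₁ v * (u ∙ w)
bac-cab₁ ⟨ u₁ , u₂ , u₃ ⟩ ⟨ v₁ , v₂ , v₃ ⟩ ⟨ w₁ , w₂ , w₃ ⟩ = identity u₁ u₂ u₃ v₁ v₂ v₃ w₁ w₂ w₃
  where
  identity : ∀ u₁ u₂ u₃ v₁ v₂ v₃ w₁ w₂ w₃ →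
    u₁ * (v₁ * w₁ + v₂ * w₂ + v₃ * w₃)
    ≡ w₂ * (u₁ * v₂ - u₂ * v₁) - w₃ * (u₃ * v₁ - u₁ * v₃) + v₁ * (u₁ * w₁ + u₂ * w₂ + u₃ * w₃)
  identity = solve-∀

-- Over 𝔽ℓ: if u × v = 0 and u·w = 0 but v·w ≠ 0, then u = 0 (by w × (u × v) = (v·w) u − (u·w) v).
cross-divisible⇒divisible : ∀ {ℓ} u v w → Prime ℓ →
  + ℓ ∣³ u ⨯ v → + ℓ ∣ u ∙ w → ¬ (+ ℓ ∣ v ∙ w) → + ℓ ∣³ u
cross-divisible⇒divisible {ℓ} u v w ℓ-prime (ℓ∣c₁ , ℓ∣c₂ , ℓ∣c₃) ℓ∣uw ℓ∤vw =
  first u v w ℓ∣c₂ ℓ∣c₃ ℓ∣uw ℓ∤vw ,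
  first (rotate u) (rotate v) (rotate w) ℓ∣c₃ ℓ∣c₁ (rotated u w ℓ∣uw) (ℓ∤vw ∘ rotated⁻¹ v w) ,
  first (rotate (rotate u)) (rotate (rotate v)) (rotate (rotate w)) ℓ∣c₁ ℓ∣c₂
    (rotated (rotate u) (rotate w) (rotated u w ℓ∣uw)) (ℓ∤vw ∘ rotated⁻¹ v w ∘ rotated⁻¹ (rotate v) (rotate w))
  where
  first : ∀ u v w → + ℓ ∣ x₂ (u ⨯ v) → + ℓ ∣ x₃ (u ⨯ v) → + ℓ ∣ u ∙ w → ¬ (+ ℓ ∣ v ∙ w) → + ℓ ∣ x₁ u
  first u v w ℓ∣c₂ ℓ∣c₃ ℓ∣uw ℓ∤vw = prime∣m*n∤n⇒∣m (x₁ u) (v ∙ w) ℓ-prime ℓ∤vw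
    (subst (+ ℓ ∣_) (sym (bac-cab₁ u v w))
      (∣m∣n⇒∣m+n (∣m∣n⇒∣m-n (∣n⇒∣m*n (x₂ w) ℓ∣c₃) (∣n⇒∣m*n (x₃ w) ℓ∣c₂)) (∣n⇒∣m*n (x₁ v) ℓ∣uw)))
  rotated : ∀ u w → + ℓ ∣ u ∙ w → + ℓ ∣ rotate u ∙ rotate w
  rotated u w = subst (+ ℓ ∣_) (sym (∙-rotate u w))
  rotated⁻¹ : ∀ u w → + ℓ ∣ rotate u ∙ rotate w → + ℓ ∣ u ∙ w
  rotated⁻¹ u w = subst (+ ℓ ∣_) (∙-rotate u w)

coords : M2 ℤ → ℤ³
coords X = ⟨ a X , b X , c X ⟩

fromCoords : ℤ³ → M2 ℤ
fromCoords x = mat (x₁ x) (x₂ x) (x₃ x) (+ 0)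

polarCoeffs : M2 ℤ → ℤ³
polarCoeffs A = ⟨ + 2 * a A , c A , b A ⟩

polar≡∙ : ∀ A X → ⟪ A , X ⟫ ≡ polarCoeffs A ∙ coords X
polar≡∙ (mat a₁ b₁ c₁ _) (mat x y z _) = identity a₁ b₁ c₁ x y z
  where
  identity : ∀ a₁ b₁ c₁ x y z → a₁ * x + b₁ * z + (x * a₁ + y * c₁) ≡ + 2 * a₁ * x + c₁ * y + b₁ * z
  identity = solve-∀

polar-comm : ∀ A B → ⟪ A , B ⟫ ≡ ⟪ B , A ⟫
polar-comm A B = +-comm (a (A *ᴹ B)) (a (B *ᴹ A))

polar-self : ∀ A → ⟪ A , A ⟫ ≡ + 2 * a (A *ᴹ A)
polar-self A = sym (*-2 (a (A *ᴹ A)))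
  where
  *-2 : ∀ x → + 2 * x ≡ x + x
  *-2 = solve-∀

polar-scaleʳ : ∀ A B γ → ⟪ A , γ ·ᴹ B ⟫ ≡ γ * ⟪ A , B ⟫
polar-scaleʳ (mat a₁ b₁ c₁ _) (mat a₂ b₂ c₂ _) γ = identity a₁ b₁ c₁ a₂ b₂ c₂ γ
  where
  identity : ∀ a₁ b₁ c₁ a₂ b₂ c₂ γ →
    a₁ * (γ * a₂) + b₁ * (γ * c₂) + (γ * a₂ * a₁ + γ * b₂ * c₁) ≡ γ * (a₁ * a₂ + b₁ * c₂ + (a₂ * a₁ + b₂ * c₁))
  identity = solve-∀

nondegenerate : ∀ {ℓ e f} A B → Prime ℓ → ¬ (+ ℓ ∣ + 2 * f) → ¬ (+ ℓ * + ℓ ∣ e) →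
  + ℓ * + ℓ ∣ a (A *ᴹ A) + e → + ℓ ∣ a (B *ᴹ B) + f → + ℓ ∣ ⟪ A , B ⟫ →
  ¬ (+ ℓ ∣³ polarCoeffs A ⨯ polarCoeffs B)
nondegenerate {ℓ} {e} {f} A B ℓ-prime ℓ∤2f ℓ²∤e ℓ²∣AA+e ℓ∣BB+f ℓ∣AB ℓ∣cross =
  ℓ²∤e (∣m+n∣m⇒∣n ℓ²∣AA+e (∣m∣n⇒∣m+n (∣-*-∣ ℓ∣a ℓ∣a) (∣-*-∣ ℓ∣b ℓ∣c)))
  where
  ℓ∤BB : ¬ (+ ℓ ∣ polarCoeffs B ∙ coords B)
  ℓ∤BB ℓ∣BB = ℓ∤2f (∣m+n∣m⇒∣n (subst (+ ℓ ∣_) (*-distribˡ-+ (+ 2) (a (B *ᴹ B)) f) (∣n⇒∣m*n (+ 2) ℓ∣BB+f))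
                               (subst (+ ℓ ∣_) (trans (sym (polar≡∙ B B)) (polar-self B)) ℓ∣BB))
  ℓ∣A : + ℓ ∣³ polarCoeffs A
  ℓ∣A = cross-divisible⇒divisible (polarCoeffs A) (polarCoeffs B) (coords B) ℓ-prime ℓ∣cross
          (subst (+ ℓ ∣_) (polar≡∙ A B) ℓ∣AB) ℓ∤BB
  ℓ∣a : + ℓ ∣ a A
  ℓ∣a = prime∣m*n∤m⇒∣n (+ 2) (a A) ℓ-prime (λ ℓ∣2 → ℓ∤2f (∣m⇒∣m*n f ℓ∣2)) (proj₁ ℓ∣A)
  ℓ∣c : + ℓ ∣ c A
  ℓ∣c = proj₁ (proj₂ ℓ∣A)
  ℓ∣b : + ℓ ∣ b A
  ℓ∣b = proj₂ (proj₂ ℓ∣A)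

record Lifting (ℓ : ℕ) (e f Q : ℤ) (A B : M2 ℤ) : Set where
  field
    X Y : M2 ℤ
    square-A : + ℓ * Q ∣ a ((A +ᴹ Q ·ᴹ X) *ᴹ (A +ᴹ Q ·ᴹ X)) + e
    square-B : + ℓ * Q ∣ a ((B +ᴹ Q ·ᴹ Y) *ᴹ (B +ᴹ Q ·ᴹ Y)) + f
    anticommute : + ℓ * Q ∣ ⟪ A +ᴹ Q ·ᴹ X , B +ᴹ Q ·ᴹ Y ⟫

lift-mod-ℓQ : ∀ {ℓ} e f Q A B → Prime ℓ → ¬ (+ ℓ ∣ + 2 * f) → ¬ (+ ℓ * + ℓ ∣ e) → + ℓ * + ℓ ∣ Q →
  Q ∣ a (A *ᴹ A) + e → Q ∣ a (B *ᴹ B) + f → Q ∣ ⟪ A , B ⟫ → Lifting ℓ e f Q A B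
lift-mod-ℓQ {ℓ} e f Q A B ℓ-prime ℓ∤2f ℓ²∤e ℓ²∣Q
            Q∣AA+e@(divides s AA+e≡sQ) Q∣BB+f@(divides t BB+f≡tQ) Q∣AB@(divides k AB≡kQ) =
  record
    { X = fromCoords x
    ; Y = γ ·ᴹ B
    ; square-A = lift-square A (fromCoords x) ℓ∣Q
                   (subst (+ ℓ * Q ∣_) (sym square-A≡) (first-order ℓ∣s+ux (+ 0)))
    ; square-B = lift-square B (γ ·ᴹ B) ℓ∣Q
                   (subst (+ ℓ * Q ∣_) (sym square-B≡) (first-order (∣n⇒∣m*n (- t) ℓ∣ν2f-1) (+ 2 * γ * t)))
    ; anticommute = lift-polar A B (fromCoords x) (γ ·ᴹ B) ℓ∣Q
                      (subst (+ ℓ * Q ∣_) (sym anticommutator≡) (first-order ℓ∣k+vx (γ * k)))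
    }
  where
  open ≡-Reasoning
  ℓ∣Q : + ℓ ∣ Q
  ℓ∣Q = m*m∣n⇒m∣n ℓ²∣Q
  solution : SolvableMod (+ ℓ) (polarCoeffs A) (polarCoeffs B) s k
  solution = solvable-mod-prime (polarCoeffs A) (polarCoeffs B) s k ℓ-prime
    (nondegenerate A B ℓ-prime ℓ∤2f ℓ²∤e (∣-trans ℓ²∣Q Q∣AA+e) (∣-trans ℓ∣Q Q∣BB+f) (∣-trans ℓ∣Q Q∣AB))
  x : ℤ³
  x = proj₁ solution
  ℓ∣s+ux : + ℓ ∣ s + polarCoeffs A ∙ x
  ℓ∣s+ux = proj₁ (proj₂ solution)
  ℓ∣k+vx : + ℓ ∣ k + polarCoeffs B ∙ x
  ℓ∣k+vx = proj₂ (proj₂ solution)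
  inverse : Σ ℤ λ ν → + ℓ ∣ ν * (+ 2 * f) - + 1
  inverse = inverse-mod-prime (+ 2 * f) ℓ-prime ℓ∤2f
  ν : ℤ
  ν = proj₁ inverse
  ℓ∣ν2f-1 : + ℓ ∣ ν * (+ 2 * f) - + 1
  ℓ∣ν2f-1 = proj₂ inverse
  γ : ℤ
  γ = ν * t
  first-order : ∀ {r} → + ℓ ∣ r → ∀ z → + ℓ * Q ∣ r * Q + Q * Q * z
  first-order ℓ∣r z = ∣m∣n⇒∣m+n (*-monoˡ-∣ Q ℓ∣r) (∣m⇒∣m*n z (*-monoˡ-∣ Q ℓ∣Q))
  square-A≡ : a (A *ᴹ A) + e + Q * ⟪ A , fromCoords x ⟫ ≡ (s + polarCoeffs A ∙ x) * Q + Q * Q * + 0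
  square-A≡ = begin
    a (A *ᴹ A) + e + Q * ⟪ A , fromCoords x ⟫   ≡⟨ cong₂ (λ z w → z + Q * w) AA+e≡sQ (polar≡∙ A (fromCoords x)) ⟩
    s * Q + Q * (polarCoeffs A ∙ x)             ≡⟨ collect s Q (polarCoeffs A ∙ x) ⟩
    (s + polarCoeffs A ∙ x) * Q + Q * Q * + 0   ∎
    where
    collect : ∀ s Q y → s * Q + Q * y ≡ (s + y) * Q + Q * Q * + 0
    collect = solve-∀
  square-B≡ : a (B *ᴹ B) + f + Q * ⟪ B , γ ·ᴹ B ⟫ ≡ - t * (ν * (+ 2 * f) - + 1) * Q + Q * Q * (+ 2 * γ * t)
  square-B≡ = begin
    a (B *ᴹ B) + f + Q * ⟪ B , γ ·ᴹ B ⟫                        ≡⟨ cong (λ w → a (B *ᴹ B) + f + Q * w) polar-B-γB ⟩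
    a (B *ᴹ B) + f + Q * (γ * (+ 2 * a (B *ᴹ B)))              ≡⟨ factor (a (B *ᴹ B)) f Q γ ⟩
    (a (B *ᴹ B) + f) * (+ 1 + + 2 * γ * Q) - + 2 * γ * Q * f   ≡⟨ cong (λ w → w * (+ 1 + + 2 * γ * Q) - + 2 * γ * Q * f) BB+f≡tQ ⟩
    t * Q * (+ 1 + + 2 * γ * Q) - + 2 * γ * Q * f              ≡⟨ expand t Q ν f ⟩
    - t * (ν * (+ 2 * f) - + 1) * Q + Q * Q * (+ 2 * γ * t)    ∎
    where
    polar-B-γB : ⟪ B , γ ·ᴹ B ⟫ ≡ γ * (+ 2 * a (B *ᴹ B))
    polar-B-γB = trans (polar-scaleʳ B B γ) (cong (γ *_) (polar-self B))
    factor : ∀ β f Q γ → β + f + Q * (γ * (+ 2 * β)) ≡ (β + f) * (+ 1 + + 2 * γ * Q) - + 2 * γ * Q * f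
    factor = solve-∀
    expand : ∀ t Q ν f → t * Q * (+ 1 + + 2 * (ν * t) * Q) - + 2 * (ν * t) * Q * f
                         ≡ - t * (ν * (+ 2 * f) - + 1) * Q + Q * Q * (+ 2 * (ν * t) * t)
    expand = solve-∀
  anticommutator≡ : ⟪ A , B ⟫ + Q * (⟪ A , γ ·ᴹ B ⟫ + ⟪ fromCoords x , B ⟫)
                    ≡ (k + polarCoeffs B ∙ x) * Q + Q * Q * (γ * k)
  anticommutator≡ = begin
    ⟪ A , B ⟫ + Q * (⟪ A , γ ·ᴹ B ⟫ + ⟪ fromCoords x , B ⟫) ≡⟨ cong₂ (λ z w → ⟪ A , B ⟫ + Q * (z + w)) (polar-scaleʳ A B γ) polar-X-B ⟩
    ⟪ A , B ⟫ + Q * (γ * ⟪ A , B ⟫ + polarCoeffs B ∙ x)     ≡⟨ cong (λ z → z + Q * (γ * z + polarCoeffs B ∙ x)) AB≡kQ ⟩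
    k * Q + Q * (γ * (k * Q) + polarCoeffs B ∙ x)           ≡⟨ collect k Q γ (polarCoeffs B ∙ x) ⟩
    (k + polarCoeffs B ∙ x) * Q + Q * Q * (γ * k)           ∎
    where
    polar-X-B : ⟪ fromCoords x , B ⟫ ≡ polarCoeffs B ∙ x
    polar-X-B = trans (polar-comm (fromCoords x) B) (polar≡∙ B (fromCoords x))
    collect : ∀ k Q γ y → k * Q + Q * (γ * (k * Q) + y) ≡ (k + y) * Q + Q * Q * (γ * k)
    collect = solve-∀

record Solution (ε p q : ℕ) : Set where
  constructor solution
  field
    A B : M2 ℤ
    A-traceFree : TraceFree q A
    B-traceFree : TraceFree q B
    relations : QuatRel q ε p A B
open Solution

_≡ˢ_[mod_] : ∀ {ε p q q′} → Solution ε p q′ → Solution ε p q → ℕ → Set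
S′ ≡ˢ S [mod n ] = (A S′ ≡ᴹ A S [mod n ]) × (B S′ ≡ᴹ B S [mod n ])

Liftable : ℕ → ℕ → ℕ → Set
Liftable ℓ ε p = ∀ m → 2 ≤ m → (S : Solution ε p (ℓ ^ m)) →
  Σ (Solution ε p (ℓ ^ suc m)) λ S′ → S′ ≡ˢ S [mod ℓ ^ m ]

ℓ*ℓ∣ℓ^[2+n] : ∀ ℓ n → + ℓ * + ℓ ∣ + (ℓ ^ suc (suc n))
ℓ*ℓ∣ℓ^[2+n] ℓ n = subst (+ ℓ * + ℓ ∣_) (sym (trans (pos-* ℓ (ℓ ℕ.* ℓ ^ n)) (cong (+ ℓ *_) (pos-* ℓ (ℓ ^ n)))))
  (*-monoʳ-∣ (+ ℓ) (∣m⇒∣m*n (+ (ℓ ^ n)) ∣-refl))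

lift : ∀ {p ε ℓ} → Prime p → IsEpsilon p ε → Prime ℓ → ℓ ≢ 2 → ℓ ≢ p → Liftable ℓ ε p
lift {p} {ε} {ℓ} p-prime ε-ok ℓ-prime ℓ≢2 ℓ≢p (suc (suc n)) (s≤s (s≤s z≤n))
     (solution A B A-traceFree B-traceFree ((AA≡-ε , _) , (BB≡-p , _) , (AB≡-BA , _))) =
  solution (traceFreePart A′) (traceFreePart B′) (traceFreePart-traceFree _ A′) (traceFreePart-traceFree _ B′)
    (quatRel-traceFreePart A′ B′ (mod-ℓQ square-A) (mod-ℓQ square-B) (mod-ℓQ anticommute)) ,
  traceFreePart-lift A X A-traceFree , traceFreePart-lift B Y B-traceFree
  where
  Q = ℓ ^ suc (suc n)
  ℓ²∤ε : ¬ (+ ℓ * + ℓ ∣ + ε)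
  ℓ²∤ε = prime-square∤ε ℓ-prime ε-ok ∘ subst (_∣ℕ ε) (abs-* (+ ℓ) (+ ℓ)) ∘ ∣⇒∣ᵤ
  open Lifting (lift-mod-ℓQ (+ ε) (+ p) (+ Q) A B ℓ-prime
    (odd-prime∤2p ℓ-prime ℓ≢2 p-prime ℓ≢p) ℓ²∤ε (ℓ*ℓ∣ℓ^[2+n] ℓ n)
    (≡-neg-mod⇒∣ (a (A *ᴹ A)) (+ ε) AA≡-ε) (≡-neg-mod⇒∣ (a (B *ᴹ B)) (+ p) BB≡-p)
    (≡-neg-mod⇒∣ (a (A *ᴹ B)) (a (B *ᴹ A)) AB≡-BA))
  A′ = A +ᴹ + Q ·ᴹ X
  B′ = B +ᴹ + Q ·ᴹ Y
  mod-ℓQ : ∀ {z} → + ℓ * + Q ∣ z → + (ℓ ℕ.* Q) ∣ z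
  mod-ℓQ = subst (_∣ _) (sym (pos-* ℓ Q))

^-monoʳ-∣ : ∀ ℓ {n m} → n ≤ m → ℓ ^ n ∣ℕ ℓ ^ m
^-monoʳ-∣ ℓ z≤n = ℕ.1∣ _
^-monoʳ-∣ ℓ (s≤s n≤m) = ℕ.*-monoʳ-∣ ℓ (^-monoʳ-∣ ℓ n≤m)

-- All digits below level m are x 0.
limit : ∀ {ℓ} m (x : ℕ → ℤ) → (∀ j → x (suc j) ≡ x j [mod ℓ ^ (j ℕ.+ m) ]) → ℤ-adic ℓ
limit {ℓ} m x x-coherent = padic (λ n → x (n ∸ m)) digits-coherent
  where
  digits-coherent : ∀ n → x (suc n ∸ m) ≡ x (n ∸ m) [mod ℓ ^ n ]
  digits-coherent n with m ≤? n
  ... | yes m≤n rewrite +-∸-assoc 1 m≤n =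
    subst (λ k → x (suc (n ∸ m)) ≡ x (n ∸ m) [mod ℓ ^ k ]) (m∸n+n≡m m≤n) (x-coherent (n ∸ m))
  ... | no m≰n rewrite m≤n⇒m∸n≡0 (≰⇒> m≰n) | m≤n⇒m∸n≡0 (<⇒≤ (≰⇒> m≰n)) = ≡-mod-refl (x 0)

limitᴹ : ∀ {ℓ} m (X : ℕ → M2 ℤ) → (∀ j → X (suc j) ≡ᴹ X j [mod ℓ ^ (j ℕ.+ m) ]) → M2 (ℤ-adic ℓ)
limitᴹ m X X-coherent =
  mat (limit m (λ j → a (X j)) (λ j → proj₁ (X-coherent j)))
      (limit m (λ j → b (X j)) (λ j → proj₁ (proj₂ (X-coherent j))))
      (limit m (λ j → c (X j)) (λ j → proj₁ (proj₂ (proj₂ (X-coherent j)))))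
      (limit m (λ j → d (X j)) (λ j → proj₂ (proj₂ (proj₂ (X-coherent j)))))

module Tower {ℓ ε p} (lifts : Liftable ℓ ε p) {m} (2≤m : 2 ≤ m) (S₀ : Solution ε p (ℓ ^ m)) where

  level : ∀ j → Solution ε p (ℓ ^ (j ℕ.+ m))
  level zero = S₀
  level (suc j) = proj₁ (lifts (j ℕ.+ m) (≤-trans 2≤m (m≤n+m m j)) (level j))

  level-coherent : ∀ j → level (suc j) ≡ˢ level j [mod ℓ ^ (j ℕ.+ m) ]
  level-coherent j = proj₂ (lifts (j ℕ.+ m) (≤-trans 2≤m (m≤n+m m j)) (level j))

  A∞ : M2 (ℤ-adic ℓ)
  A∞ = limitᴹ m (λ j → A (level j)) (λ j → proj₁ (level-coherent j))

  B∞ : M2 (ℤ-adic ℓ)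
  B∞ = limitᴹ m (λ j → B (level j)) (λ j → proj₂ (level-coherent j))

  A∞≡A₀ : reduce A∞ m ≡ᴹ A S₀ [mod ℓ ^ m ]
  A∞≡A₀ rewrite n∸n≡0 m = ≡ᴹ-refl (A S₀)

  B∞≡B₀ : reduce B∞ m ≡ᴹ B S₀ [mod ℓ ^ m ]
  B∞≡B₀ rewrite n∸n≡0 m = ≡ᴹ-refl (B S₀)

  relations∞ : ∀ n → QuatRel (ℓ ^ n) ε p (reduce A∞ n) (reduce B∞ n)
  relations∞ n with m ≤? n
  ... | yes m≤n = subst (λ k → QuatRel (ℓ ^ k) ε p (A (level (n ∸ m))) (B (level (n ∸ m))))
                        (m∸n+n≡m m≤n) (relations (level (n ∸ m)))
  ... | no m≰n rewrite m≤n⇒m∸n≡0 (<⇒≤ (≰⇒> m≰n)) =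
    quatRel-weaken (A S₀) (B S₀) (^-monoʳ-∣ ℓ (<⇒≤ (≰⇒> m≰n))) (relations S₀)

ℓ-adic-solution : ∀ {ℓ ε p} → Liftable ℓ ε p → ∀ m → 2 ≤ m → (S₀ : Solution ε p (ℓ ^ m)) →
  Σ (M2 (ℤ-adic ℓ)) λ A∞ → Σ (M2 (ℤ-adic ℓ)) λ B∞ →
    (reduce A∞ m ≡ᴹ A S₀ [mod ℓ ^ m ]) × (reduce B∞ m ≡ᴹ B S₀ [mod ℓ ^ m ]) ×
    ((n : ℕ) → QuatRel (ℓ ^ n) ε p (reduce A∞ n) (reduce B∞ n))
ℓ-adic-solution lifts m 2≤m S₀ = A∞ , B∞ , A∞≡A₀ , B∞≡B₀ , relations∞
  where open Tower lifts 2≤m S₀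

mainTheorem1 : (p ε ℓ : ℕ) → Prime p → IsEpsilon p ε →
    Prime ℓ → ℓ ≢ 2 → ℓ ≢ p →
    ((m : ℕ) → 2 ≤ m → (A₀ B₀ : M2 ℤ) →
      TraceFree (ℓ ^ m) A₀ → TraceFree (ℓ ^ m) B₀ → QuatRel (ℓ ^ m) ε p A₀ B₀ →
      Σ (M2 ℤ) λ A₁ → Σ (M2 ℤ) λ B₁ →
        TraceFree (ℓ ^ suc m) A₁ × TraceFree (ℓ ^ suc m) B₁ ×
        (A₁ ≡ᴹ A₀ [mod ℓ ^ m ]) × (B₁ ≡ᴹ B₀ [mod ℓ ^ m ]) ×
        QuatRel (ℓ ^ suc m) ε p A₁ B₁)
    ×
    ((m : ℕ) → 2 ≤ m → (A₀ B₀ : M2 ℤ) →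
      TraceFree (ℓ ^ m) A₀ → TraceFree (ℓ ^ m) B₀ → QuatRel (ℓ ^ m) ε p A₀ B₀ →
      Σ (M2 (ℤ-adic ℓ)) λ A → Σ (M2 (ℤ-adic ℓ)) λ B →
        (reduce A m ≡ᴹ A₀ [mod ℓ ^ m ]) × (reduce B m ≡ᴹ B₀ [mod ℓ ^ m ]) ×
        ((n : ℕ) → QuatRel (ℓ ^ n) ε p (reduce A n) (reduce B n)))
mainTheorem1 p ε ℓ p-prime ε-ok ℓ-prime ℓ≢2 ℓ≢p =
  (λ m 2≤m A₀ B₀ A₀-traceFree B₀-traceFree rel →
    let (S₁ , A₁≡A₀ , B₁≡B₀) = lifts m 2≤m (solution A₀ B₀ A₀-traceFree B₀-traceFree rel)
    in A S₁ , B S₁ , A-traceFree S₁ , B-traceFree S₁ , A₁≡A₀ , B₁≡B₀ , relations S₁) ,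
  (λ m 2≤m A₀ B₀ A₀-traceFree B₀-traceFree rel →
    ℓ-adic-solution lifts m 2≤m (solution A₀ B₀ A₀-traceFree B₀-traceFree rel))
  where
  lifts : Liftable ℓ ε p
  lifts = lift p-prime ε-ok ℓ-prime ℓ≢2 ℓ≢p
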